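{- For all $n\ge 1$ and $k\in[n]$, the map $\rho$ is a bijection from $\mathcal{DU}_{n,k}$ onto $\mathcal{MM}'_{n,k}$.
   Context: $[n]=\{1,\dots,n\}$. $\mathcal{DU}_{n,k}$ is the set of permutations $\pi$ of $[n]$ with $\pi_1>\pi_2<\pi_3>\cdots$ and $\pi_1=k$. A permutation is alternating if $\pi_1>\pi_2<\pi_3>\cdots$ or $\pi_1<\pi_2>\pi_3<\cdots$; $\mathcal{MM}_n$ is the set of alternating permutations of $[n]$ in which $1$ occurs before $n$. For $k\le n-1$, $\mathcal{MM}'_{n,k}$ is the set of $\pi\in\mathcal{MM}_n$ in which the letter immediately before $1$ is $k$; $\mathcal{MM}'_{n,n}$ is the set of $\pi\in\mathcal{MM}_n$ with $\pi_1=1$. For a word $w=w_1\cdots w_m$, $w^R=w_m\cdots w_1$. For a finite ordered set $J=\{b_1<\dots<b_r\}$, let $\sigma_J$ be the order-reversing bijection $b_i\mapsto b_{r+1-i}$ of $J$. The map $\rho$ on $\mathcal{DU}_{n,k}$: if $k=n$, $\rho(\pi)=\overline{\pi}$ where $\overline{\pi}_i=n+1-\pi_i$. If $k\le n-1$ and $1$ occurs before $n$ in $\pi$, write $\pi=\sigma_1\,1\,\sigma_2$ and set $\rho(\pi)=\sigma_1^R\,1\,\sigma_2$. If $k\le n-1$ and $n$ occurs before $1$, write $\pi=\sigma_1\,n\,\sigma_2$, let $J$ be the set of letters of $\sigma_2$ together with $n$, let $\tau$ be the word obtained from $\sigma_2$ by applying $\sigma_J$ to each letter, and set $\rho(\pi)=\sigma_1^R\,1\,\tau$.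 -}

module Defs where

open import Data.Nat using (ℕ; zero; suc; _<_; _∸_; _≟_; _<ᵇ_)
open import Data.Nat.ListAction using (sum)
open import Data.List using (List; []; _∷_; _++_; map; upTo; reverse; length; filter)
open import Data.List.Relation.Binary.Permutation.Propositional using (_↭_)
open import Data.List.Membership.Propositional using (_∉_)
open import Data.Product using (Σ; _×_; _,_; ∃; ∃-syntax)
open import Data.Sum using (_⊎_)
open import Data.Unit using (⊤)
open import Data.Bool using (Bool; true; false; if_then_else_)
open import Relation.Nullary using (yes; no)
open import Relation.Nullary.Decidable using (⌊_⌋)
open import Relation.Binary.PropositionalEquality using (_≡_)

[1‥_] : ℕ → List ℕ
[1‥ n ] = map suc (upTo n)

-- π is a permutation of [n] (in one-line notation)
IsPerm : ℕ → List ℕ → Set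
IsPerm n π = π ↭ [1‥ n ]

mutual
  DownStart : List ℕ → Set
  DownStart []           = ⊤
  DownStart (x ∷ [])     = ⊤
  DownStart (x ∷ y ∷ r)  = y < x × UpStart (y ∷ r)

  UpStart : List ℕ → Set
  UpStart []           = ⊤
  UpStart (x ∷ [])     = ⊤
  UpStart (x ∷ y ∷ r)  = x < y × DownStart (y ∷ r)

DU : ℕ → ℕ → List ℕ → Set
DU n k π = IsPerm n π × DownStart π × Σ (List ℕ) (λ rest → π ≡ k ∷ rest)

Alternating : List ℕ → Set
Alternating π = DownStart π ⊎ UpStart π

-- 1 occurs before n: π = α 1 β with n not in α (for n = 1 this holds trivially)
OneBeforeN : ℕ → List ℕ → Set
OneBeforeN n π = ∃[ α ] ∃[ β ] (π ≡ α ++ 1 ∷ β × n ∉ α)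

MM : ℕ → List ℕ → Set
MM n π = IsPerm n π × Alternating π × OneBeforeN n π

MM' : ℕ → ℕ → List ℕ → Set
MM' n k π with k ≟ n
... | yes _ = MM n π × Σ (List ℕ) (λ rest → π ≡ 1 ∷ rest)
... | no  _ = MM n π × ∃[ α ] ∃[ β ] (π ≡ α ++ k ∷ 1 ∷ β)

complement : ℕ → List ℕ → List ℕ
complement n = map (λ x → suc n ∸ x)

-- order-reversing bijection σ_J of a finite set J (given as a list of distinct numbers):
-- x with rank i from below (i = #{y ∈ J | y < x}) goes to the element of J with rank i from above
countBelow : List ℕ → ℕ → ℕ
countBelow J x = length (filter (λ y → y Data.Nat.<? x) J)

countAbove : List ℕ → ℕ → ℕ
countAbove J x = length (filter (λ y → x Data.Nat.<? y) J)

findRank : List ℕ → List ℕ → ℕ → ℕ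
findRank J []      i = 0
findRank J (y ∷ ys) i = if ⌊ countAbove J y ≟ i ⌋ then y else findRank J ys i

σ : List ℕ → ℕ → ℕ
σ J x = findRank J J (countBelow J x)

-- which of 1 and n occurs first, with the split around it
data Split : Set where
  oneFirst : List ℕ → List ℕ → Split
  nFirst   : List ℕ → List ℕ → Split
  neither  : Split

consSplit : ℕ → Split → Split
consSplit x (oneFirst a b) = oneFirst (x ∷ a) b
consSplit x (nFirst a b)   = nFirst (x ∷ a) b
consSplit x neither        = neither

split : ℕ → List ℕ → Split
split n [] = neither
split n (x ∷ xs) with x ≟ 1 | x ≟ n
... | yes _ | _     = oneFirst [] xs
... | no _  | yes _ = nFirst [] xs
... | no _  | no _  = consSplit x (split n xs)

ρ : ℕ → ℕ → List ℕ → List ℕ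
ρ n k π with k ≟ n
... | yes _ = complement n π
... | no _ with split n π
...   | oneFirst s₁ s₂ = reverse s₁ ++ 1 ∷ s₂
...   | nFirst s₁ s₂   = reverse s₁ ++ 1 ∷ map (σ (n ∷ s₂)) s₂
...   | neither        = π

-- For k = n, ρ is complementation x ↦ n + 1 − x, an order-reversing involution of [n]: it swaps
-- down-up and up-down permutations and turns a leading n into a leading 1.
--
-- For k < n, write π = k s m v, where m is whichever of 1 and n occurs first. Then ρ(π) = (k s)ᴿ 1 X
-- with X = v if m = 1, and X = σ_J(v) for J = {n} ∪ v if m = n; in the latter case σ_J reverses the
-- order of J and sends n to 1, since 1 ∈ J. As 1 is smaller than its neighbours on both sides,
-- reversing the prefix keeps the word alternating, and k now stands directly before 1, with n to its
-- right. The letter before m descends into m when m = 1 and ascends into it when m = n, so the parity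
-- of |s| recovers m from ρ(π); together with σ_J being an involution this makes ρ injective. For
-- τ = α k 1 β in MM', the direction of the first step of τ decides which of the two shapes its
-- preimage has, and the same parity argument shows that the reversed word starts with a descent.

module Submission where

open import Defs
open import Data.Nat using (ℕ; _≤_)
open import Data.List using (List)
open import Data.Product using (_×_; ∃-syntax)
open import Relation.Binary.PropositionalEquality using (_≡_)

open import Data.Bool using (Bool; true; false; not)
open import Data.Bool.Properties using (not-involutive)
open import Data.Empty using (⊥; ⊥-elim)
open import Data.List using ([]; _∷_; _++_; [_]; length; filter; map; reverse)
open import Data.List.Properties
  using ( ʳ++-defn; ∷-injective; ∷-injectiveˡ; ∷-injectiveʳ; ++-assoc; map-∘; map-id-local
        ; filter-accept; filter-reject; filter-none; length-filter
        ; reverse-injective; reverse-involutive; reverse-++)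
open import Data.List.Membership.Propositional using (_∈_; _∉_)
open import Data.List.Membership.Propositional.Properties
  using (∈-map⁺; ∈-map⁻; ∈-∃++; ∈-upTo⁺; ∈-upTo⁻; ∈-++⁺ˡ; ∈-++⁺ʳ; ∈-++⁻)
open import Data.List.Membership.Propositional.Properties.WithK using (unique∧set⇒bag)
open import Data.List.Relation.Binary.BagAndSetEquality using (∼bag⇒↭)
open import Data.List.Relation.Binary.Permutation.Propositional using (_↭_; ↭⇒↭ₛ; ↭-sym; ↭-trans)
open import Data.List.Relation.Binary.Permutation.Propositional.Properties as Perm
  using (∈-resp-↭; shift; filter-↭; ↭-length; ↭-reverse; ++⁺ʳ)
import Data.List.Relation.Binary.Permutation.Setoid.Properties as PermSetoid
open import Data.List.Relation.Unary.All as All using (All; []; _∷_)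
open import Data.List.Relation.Unary.All.Properties as All using ()
open import Data.List.Relation.Unary.Any using (here; there)
open import Data.List.Relation.Unary.Unique.Propositional using (Unique; []; _∷_)
open import Data.List.Relation.Unary.Unique.Propositional.Properties as Unique
  using (upTo⁺; Unique[x∷xs]⇒x∉xs)
open import Data.Nat using (zero; suc; _+_; _∸_; _<_; _≟_; _<?_; z≤n; s≤s)
open import Data.Nat.Properties
open import Data.Product using (_,_; ∃; ∃₂; proj₁; proj₂)
open import Data.Sum using (_⊎_; inj₁; inj₂)
open import Data.Unit using (⊤; tt)
open import Function using (id; _∘_; case_of_)
open import Function.Bundles using (_⇔_; mk⇔; Equivalence)
open import Relation.Binary.Definitions using (tri<; tri≈; tri>)
open import Relation.Binary.PropositionalEquality
  using (_≢_; refl; sym; trans; cong; cong₂; subst; subst₂; setoid; module ≡-Reasoning)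
open import Relation.Nullary using (¬_; yes; no)
open import Relation.Unary using (Decidable)

-- Alternating words

Step : Bool → ℕ → ℕ → Set
Step true  x y = y < x
Step false x y = x < y

Zigzag : Bool → List ℕ → Set
Zigzag d []          = ⊤
Zigzag d (x ∷ [])    = ⊤
Zigzag d (x ∷ y ∷ w) = Step d x y × Zigzag (not d) (y ∷ w)

-- In a Zigzag d word the step leaving position i has direction dirAfter i d.
dirAfter : ℕ → Bool → Bool
dirAfter zero    d = d
dirAfter (suc i) d = dirAfter i (not d)

dirAfter-∷ʳ : ∀ u {x : ℕ} d → dirAfter (length (u ++ [ x ])) (not d) ≡ dirAfter (length u) d
dirAfter-∷ʳ []      d = not-involutive d
dirAfter-∷ʳ (_ ∷ u) d = dirAfter-∷ʳ u (not d)

Step-determined : ∀ d e {x y} → Step d x y → Step e x y → d ≡ e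
Step-determined true  true  _ _ = refl
Step-determined false false _ _ = refl
Step-determined true  false s t = ⊥-elim (<-asym s t)
Step-determined false true  s t = ⊥-elim (<-asym s t)

mutual
  DownStart⇒Zigzag : ∀ w → DownStart w → Zigzag true w
  DownStart⇒Zigzag []          _       = tt
  DownStart⇒Zigzag (x ∷ [])    _       = tt
  DownStart⇒Zigzag (x ∷ y ∷ w) (s , z) = s , UpStart⇒Zigzag (y ∷ w) z

  UpStart⇒Zigzag : ∀ w → UpStart w → Zigzag false w
  UpStart⇒Zigzag []          _       = tt
  UpStart⇒Zigzag (x ∷ [])    _       = tt
  UpStart⇒Zigzag (x ∷ y ∷ w) (s , z) = s , DownStart⇒Zigzag (y ∷ w) z

mutual
  Zigzag⇒DownStart : ∀ w → Zigzag true w → DownStart w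
  Zigzag⇒DownStart []          _       = tt
  Zigzag⇒DownStart (x ∷ [])    _       = tt
  Zigzag⇒DownStart (x ∷ y ∷ w) (s , z) = s , Zigzag⇒UpStart (y ∷ w) z

  Zigzag⇒UpStart : ∀ w → Zigzag false w → UpStart w
  Zigzag⇒UpStart []          _       = tt
  Zigzag⇒UpStart (x ∷ [])    _       = tt
  Zigzag⇒UpStart (x ∷ y ∷ w) (s , z) = s , Zigzag⇒DownStart (y ∷ w) z

Zigzag⇒Alternating : ∀ d {w} → Zigzag d w → Alternating w
Zigzag⇒Alternating true  z = inj₁ (Zigzag⇒DownStart _ z)
Zigzag⇒Alternating false z = inj₂ (Zigzag⇒UpStart _ z)

Alternating⇒Zigzag : ∀ {w} → Alternating w → ∃ λ d → Zigzag d w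
Alternating⇒Zigzag (inj₁ ds) = true  , DownStart⇒Zigzag _ ds
Alternating⇒Zigzag (inj₂ us) = false , UpStart⇒Zigzag _ us

Zigzag-++ʳ : ∀ d u m v → Zigzag d (u ++ m ∷ v) → Zigzag (dirAfter (length u) d) (m ∷ v)
Zigzag-++ʳ d []          m v z       = z
Zigzag-++ʳ d (x ∷ [])    m v (_ , z) = z
Zigzag-++ʳ d (x ∷ y ∷ u) m v (_ , z) = Zigzag-++ʳ (not d) (y ∷ u) m v z

Zigzag-++ˡ : ∀ d u v → Zigzag d (u ++ v) → Zigzag d u
Zigzag-++ˡ d []          v _       = tt
Zigzag-++ˡ d (x ∷ [])    v _       = tt
Zigzag-++ˡ d (x ∷ y ∷ u) v (s , z) = s , Zigzag-++ˡ (not d) (y ∷ u) v z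

Zigzag-∷ : ∀ d {m} w → Zigzag d w → All (Step (not d) m) w → Zigzag (not d) (m ∷ w)
Zigzag-∷ d     []      _ _       = tt
Zigzag-∷ true  (x ∷ w) z (s ∷ _) = s , z
Zigzag-∷ false (x ∷ w) z (s ∷ _) = s , z

reverse-∷-++ : ∀ (x : ℕ) u w → reverse (x ∷ u) ++ w ≡ reverse u ++ x ∷ w
reverse-∷-++ x u w = trans (sym (ʳ++-defn (x ∷ u))) (ʳ++-defn u)

-- m is a turning point on both sides, so the word stays alternating when the part before it is reversed.
Zigzag-reverse-++ : ∀ e m u v → Zigzag e (m ∷ u) → Zigzag e (m ∷ v) →
                    Zigzag (dirAfter (length u) e) (reverse u ++ m ∷ v)
Zigzag-reverse-++ e     m []      v _        zv = zv
Zigzag-reverse-++ true  m (x ∷ u) v (s , zu) zv =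
  subst (Zigzag _) (sym (reverse-∷-++ x u (m ∷ v))) (Zigzag-reverse-++ false x u (m ∷ v) zu (s , zv))
Zigzag-reverse-++ false m (x ∷ u) v (s , zu) zv =
  subst (Zigzag _) (sym (reverse-∷-++ x u (m ∷ v))) (Zigzag-reverse-++ true x u (m ∷ v) zu (s , zv))

Zigzag-reverse-prefix : ∀ d u m v → Zigzag d u → All (Step (not d) m) u → Zigzag (not d) (m ∷ v) →
                        Zigzag (dirAfter (length u) (not d)) (reverse u ++ m ∷ v)
Zigzag-reverse-prefix d u m v zu bounds = Zigzag-reverse-++ (not d) m u v (Zigzag-∷ d u zu bounds)

Zigzag-step : ∀ d u {x y} v → Zigzag d (u ++ x ∷ y ∷ v) → Step (dirAfter (length u) d) x y
Zigzag-step d u v z = proj₁ (Zigzag-++ʳ d u _ (_ ∷ v) z)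

Zigzag-into-extremum : ∀ d e x u {m} v → Zigzag d (x ∷ u ++ m ∷ v) →
                       All (λ y → Step e y m) (x ∷ u) → dirAfter (length u) d ≡ e
Zigzag-into-extremum d e x []      v (s , _) (t ∷ _)  = Step-determined d e s t
Zigzag-into-extremum d e x (y ∷ u) v (_ , z) (_ ∷ ts) = Zigzag-into-extremum (not d) e y u v z ts

Zigzag-from-extremum : ∀ d e m v → Zigzag d (m ∷ v) → All (Step e m) v → Zigzag e (m ∷ v)
Zigzag-from-extremum d e m []      _       _       = tt
Zigzag-from-extremum d e m (y ∷ v) z (t ∷ _) =
  subst (λ b → Zigzag b (m ∷ y ∷ v)) (Step-determined d e (proj₁ z) t) z

Zigzag-antitone : ∀ (P : ℕ → Set) (f : ℕ → ℕ) → (∀ {x y} → P x → P y → x < y → f y < f x) →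
                  ∀ d w → All P w → Zigzag d w → Zigzag (not d) (map f w)
Zigzag-antitone P f anti d     []          _              _       = tt
Zigzag-antitone P f anti d     (x ∷ [])    _              _       = tt
Zigzag-antitone P f anti true  (x ∷ y ∷ w) (px ∷ py ∷ ps) (s , z) =
  anti py px s , Zigzag-antitone P f anti false (y ∷ w) (py ∷ ps) z
Zigzag-antitone P f anti false (x ∷ y ∷ w) (px ∷ py ∷ ps) (s , z) =
  anti px py s , Zigzag-antitone P f anti true (y ∷ w) (py ∷ ps) z

-- Duplicate-free lists and permutations of [n]

Unique-resp-↭ : ∀ {xs ys : List ℕ} → xs ↭ ys → Unique xs → Unique ys
Unique-resp-↭ p = PermSetoid.Unique-resp-↭ (setoid ℕ) (↭⇒↭ₛ p)

unique-set⇒↭ : ∀ {xs ys : List ℕ} → Unique xs → Unique ys →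
               (∀ {z} → z ∈ xs → z ∈ ys) → (∀ {z} → z ∈ ys → z ∈ xs) → xs ↭ ys
unique-set⇒↭ ux uy to from = ∼bag⇒↭ (unique∧set⇒bag ux uy (mk⇔ to from))

Unique-map⁺-on : ∀ {f : ℕ → ℕ} {xs} → (∀ {x y} → x ∈ xs → y ∈ xs → f x ≡ f y → x ≡ y) →
                 Unique xs → Unique (map f xs)
Unique-map⁺-on {xs = []}     inj []         = []
Unique-map⁺-on {xs = x ∷ xs} inj (x∉ ∷ u) =
  All.map⁺ (All.tabulate λ y∈ fx≡fy → All.lookup x∉ y∈ (inj (here refl) (there y∈) fx≡fy))
  ∷ Unique-map⁺-on (λ x∈ y∈ → inj (there x∈) (there y∈)) u

involution⇒map-↭ : ∀ {J} (f : ℕ → ℕ) → Unique J → (∀ {x} → x ∈ J → f x ∈ J) →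
                   (∀ {x} → x ∈ J → f (f x) ≡ x) → map f J ↭ J
involution⇒map-↭ {J} f u closed invol = unique-set⇒↭ (Unique-map⁺-on inj u) u to from
  where
    inj : ∀ {x y} → x ∈ J → y ∈ J → f x ≡ f y → x ≡ y
    inj x∈ y∈ fx≡fy = trans (sym (invol x∈)) (trans (cong f fx≡fy) (invol y∈))
    to : ∀ {z} → z ∈ map f J → z ∈ J
    to z∈ with ∈-map⁻ f z∈
    ... | x , x∈ , refl = closed x∈
    from : ∀ {z} → z ∈ J → z ∈ map f J
    from z∈ = subst (_∈ map f J) (invol z∈) (∈-map⁺ f (closed z∈))

Unique-++⁻ʳ : ∀ u {v : List ℕ} → Unique (u ++ v) → Unique v
Unique-++⁻ʳ []      uv       = uv
Unique-++⁻ʳ (_ ∷ u) (_ ∷ uv) = Unique-++⁻ʳ u uv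

Unique-∉-prefix : ∀ u {m : ℕ} {v} → Unique (u ++ m ∷ v) → m ∉ u
Unique-∉-prefix (x ∷ u) (x∉ ∷ _)  (here refl) = All.lookup x∉ (∈-++⁺ʳ u (here refl)) refl
Unique-∉-prefix (x ∷ u) (_ ∷ uv) (there m∈) = Unique-∉-prefix u uv m∈

++-∷-injective : ∀ {m : ℕ} u v u′ v′ → m ∉ u → m ∉ u′ →
                 u ++ m ∷ v ≡ u′ ++ m ∷ v′ → u ≡ u′ × v ≡ v′
++-∷-injective []      v []        v′ _ _ eq = refl , proj₂ (∷-injective eq)
++-∷-injective []      v (x′ ∷ u′) v′ _ m∉u′ eq = ⊥-elim (m∉u′ (here (proj₁ (∷-injective eq))))
++-∷-injective (x ∷ u) v []        v′ m∉u _ eq = ⊥-elim (m∉u (here (sym (proj₁ (∷-injective eq)))))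
++-∷-injective (x ∷ u) v (x′ ∷ u′) v′ m∉u m∉u′ eq with ∷-injective eq
... | refl , eq′ with ++-∷-injective u v u′ v′ (m∉u ∘ there) (m∉u′ ∘ there) eq′
...   | refl , refl = refl , refl

∈⇒↭-∷ : ∀ {x : ℕ} {J} → x ∈ J → ∃ λ J′ → J ↭ x ∷ J′
∈⇒↭-∷ x∈J with ∈-∃++ x∈J
... | ys , zs , refl = ys ++ zs , shift _ ys zs

∉-∷⁺ : ∀ {x z : ℕ} {u} → z ≢ x → x ∉ u → x ∉ z ∷ u
∉-∷⁺ z≢x x∉u (here x≡z) = z≢x (sym x≡z)
∉-∷⁺ z≢x x∉u (there x∈u) = x∉u x∈u

first-of : ∀ x y π → x ∈ π →
           ∃₂ λ u v → (π ≡ u ++ x ∷ v ⊎ π ≡ u ++ y ∷ v) × x ∉ u × y ∉ u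
first-of x y (z ∷ π) x∈zπ with z ≟ x | z ≟ y | x∈zπ
... | yes refl | _        | _          = [] , π , inj₁ refl , (λ ()) , (λ ())
... | no _     | yes refl | _          = [] , π , inj₂ refl , (λ ()) , (λ ())
... | no z≢x   | no _     | here x≡z   = ⊥-elim (z≢x (sym x≡z))
... | no z≢x   | no z≢y   | there x∈π with first-of x y π x∈π
...   | u , v , inj₁ refl , x∉u , y∉u = z ∷ u , v , inj₁ refl , ∉-∷⁺ z≢x x∉u , ∉-∷⁺ z≢y y∉u
...   | u , v , inj₂ refl , x∉u , y∉u = z ∷ u , v , inj₂ refl , ∉-∷⁺ z≢x x∉u , ∉-∷⁺ z≢y y∉u

∉-reverse : ∀ {x : ℕ} u → x ∉ u → x ∉ reverse u
∉-reverse u x∉u = x∉u ∘ ∈-resp-↭ (↭-reverse u)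

Unique-[1‥] : ∀ n → Unique [1‥ n ]
Unique-[1‥] n = Unique.map⁺ suc-injective (upTo⁺ n)

∈-[1‥]⁻ : ∀ {n x} → x ∈ [1‥ n ] → 1 ≤ x × x ≤ n
∈-[1‥]⁻ x∈ with ∈-map⁻ suc x∈
... | i , i∈ , refl = s≤s z≤n , ∈-upTo⁻ i∈

∈-[1‥]⁺ : ∀ {n x} → 1 ≤ x → x ≤ n → x ∈ [1‥ n ]
∈-[1‥]⁺ {x = suc i} (s≤s _) x≤n = ∈-map⁺ suc (∈-upTo⁺ x≤n)

module _ {n π} (p : IsPerm n π) where

  IsPerm⇒Unique : Unique π
  IsPerm⇒Unique = Unique-resp-↭ (↭-sym p) (Unique-[1‥] n)

  IsPerm-∈⁻ : ∀ {x} → x ∈ π → 1 ≤ x × x ≤ n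
  IsPerm-∈⁻ x∈ = ∈-[1‥]⁻ (∈-resp-↭ p x∈)

  IsPerm-∈⁺ : ∀ {x} → 1 ≤ x → x ≤ n → x ∈ π
  IsPerm-∈⁺ 1≤x x≤n = ∈-resp-↭ (↭-sym p) (∈-[1‥]⁺ 1≤x x≤n)

  IsPerm-1< : ∀ {x} → x ∈ π → x ≢ 1 → 1 < x
  IsPerm-1< x∈π x≢1 = ≤∧≢⇒< (proj₁ (IsPerm-∈⁻ x∈π)) (x≢1 ∘ sym)

  IsPerm-<n : ∀ {x} → x ∈ π → x ≢ n → x < n
  IsPerm-<n x∈π x≢n = ≤∧≢⇒< (proj₂ (IsPerm-∈⁻ x∈π)) x≢n

  IsPerm-1<-all : ∀ {w} → (∀ {x} → x ∈ w → x ∈ π) → 1 ∉ w → All (1 <_) w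
  IsPerm-1<-all w⊆π 1∉w = All.tabulate λ x∈w → IsPerm-1< (w⊆π x∈w) (λ { refl → 1∉w x∈w })

  IsPerm-<n-all : ∀ {w} → (∀ {x} → x ∈ w → x ∈ π) → n ∉ w → All (_< n) w
  IsPerm-<n-all w⊆π n∉w = All.tabulate λ x∈w → IsPerm-<n (w⊆π x∈w) (λ { refl → n∉w x∈w })

IsPerm-reverse-prefix : ∀ {n} u {w} → IsPerm n (u ++ w) → IsPerm n (reverse u ++ w)
IsPerm-reverse-prefix u {w} p = ↭-trans (++⁺ʳ w (↭-reverse u)) p

IsPerm-suffix-1< : ∀ {n} u {v} → IsPerm n (u ++ 1 ∷ v) → All (1 <_) v
IsPerm-suffix-1< u p =
  IsPerm-1<-all p (∈-++⁺ʳ u ∘ there) (Unique[x∷xs]⇒x∉xs (Unique-++⁻ʳ u (IsPerm⇒Unique p)))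

IsPerm-suffix-<n : ∀ {n} u {v} → IsPerm n (u ++ n ∷ v) → All (_< n) v
IsPerm-suffix-<n u p =
  IsPerm-<n-all p (∈-++⁺ʳ u ∘ there) (Unique[x∷xs]⇒x∉xs (Unique-++⁻ʳ u (IsPerm⇒Unique p)))

-- Ranks and the order-reversing bijection σ

count : {P : ℕ → Set} → Decidable P → List ℕ → ℕ
count P? J = length (filter P? J)

module _ {P : ℕ → Set} (P? : Decidable P) where

  count-∷-accept : ∀ {x J} → P x → count P? (x ∷ J) ≡ suc (count P? J)
  count-∷-accept px = cong length (filter-accept P? px)

  count-∷-reject : ∀ {x J} → ¬ P x → count P? (x ∷ J) ≡ count P? J
  count-∷-reject ¬px = cong length (filter-reject P? ¬px)

  count-↭ : ∀ {J K} → J ↭ K → count P? J ≡ count P? K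
  count-↭ J↭K = ↭-length (filter-↭ P? J↭K)

  count-none : ∀ {J} → All (λ w → ¬ P w) J → count P? J ≡ 0
  count-none none = cong length (filter-none P? none)

module _ {P Q : ℕ → Set} (P? : Decidable P) (Q? : Decidable Q) (P⇒Q : ∀ {w} → P w → Q w) where

  count-mono : ∀ J → count P? J ≤ count Q? J
  count-mono []      = z≤n
  count-mono (w ∷ J) with P? w | Q? w
  ... | yes _  | yes _ = s≤s (count-mono J)
  ... | yes pw | no ¬qw = ⊥-elim (¬qw (P⇒Q pw))
  ... | no _   | yes _ = m≤n⇒m≤1+n (count-mono J)
  ... | no _   | no _  = count-mono J

  count-strict : ∀ {z J} → z ∈ J → ¬ P z → Q z → suc (count P? J) ≤ count Q? J
  count-strict {z} {J} z∈J ¬pz qz with ∈⇒↭-∷ z∈J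
  ... | J′ , J↭zJ′ = subst₂ _≤_ (cong suc (sym countP)) (sym countQ) (s≤s (count-mono J′))
    where
      countP : count P? J ≡ count P? J′
      countP = trans (count-↭ P? J↭zJ′) (count-∷-reject P? ¬pz)
      countQ : count Q? J ≡ suc (count Q? J′)
      countQ = trans (count-↭ Q? J↭zJ′) (count-∷-accept Q? qz)

count-partition : ∀ {P Q : ℕ → Set} (P? : Decidable P) (Q? : Decidable Q) → (∀ {w} → P w → ¬ Q w) →
                  ∀ J → All (λ w → P w ⊎ Q w) J → count P? J + count Q? J ≡ length J
count-partition P? Q? disj []      []                = refl
count-partition P? Q? disj (w ∷ J) (inj₁ pw ∷ cover) = begin
  count P? (w ∷ J) + count Q? (w ∷ J) ≡⟨ cong₂ _+_ (count-∷-accept P? pw) (count-∷-reject Q? (disj pw)) ⟩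
  suc (count P? J + count Q? J)       ≡⟨ cong suc (count-partition P? Q? disj J cover) ⟩
  suc (length J)                      ∎
  where open ≡-Reasoning
count-partition P? Q? disj (w ∷ J) (inj₂ qw ∷ cover) = begin
  count P? (w ∷ J) + count Q? (w ∷ J) ≡⟨ cong₂ _+_ (count-∷-reject P? (λ pw → disj pw qw))
                                                    (count-∷-accept Q? qw) ⟩
  count P? J + suc (count Q? J)       ≡⟨ +-suc _ _ ⟩
  suc (count P? J + count Q? J)       ≡⟨ cong suc (count-partition P? Q? disj J cover) ⟩
  suc (length J)                      ∎
  where open ≡-Reasoning

countAbove-antitone : ∀ {y z} → y ≤ z → ∀ J → countAbove J z ≤ countAbove J y
countAbove-antitone {y} {z} y≤z = count-mono (z <?_) (y <?_) (≤-<-trans y≤z)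

countAbove-strict : ∀ {y z J} → y < z → z ∈ J → suc (countAbove J z) ≤ countAbove J y
countAbove-strict {y} {z} y<z z∈J = count-strict (z <?_) (y <?_) (<-trans y<z) z∈J (<-irrefl refl) y<z

countBelow-strict : ∀ {y z J} → y < z → y ∈ J → suc (countBelow J y) ≤ countBelow J z
countBelow-strict {y} {z} y<z y∈J = count-strict (_<? y) (_<? z) (λ w<y → <-trans w<y y<z) y∈J (<-irrefl refl) y<z

countBelow+countAbove : ∀ {J x} → Unique J → x ∈ J → suc (countBelow J x + countAbove J x) ≡ length J
countBelow+countAbove {J} {x} u x∈J with ∈⇒↭-∷ x∈J
... | J′ , J↭xJ′ = begin
  suc (countBelow J x + countAbove J x)   ≡⟨ cong suc (cong₂ _+_ (restrict (_<? x) (<-irrefl refl))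
                                                                 (restrict (x <?_) (<-irrefl refl))) ⟩
  suc (countBelow J′ x + countAbove J′ x) ≡⟨ cong suc (count-partition (_<? x) (x <?_) <-asym J′ cover) ⟩
  suc (length J′)                         ≡⟨ sym (↭-length J↭xJ′) ⟩
  length J                                ∎
  where
    open ≡-Reasoning
    restrict : ∀ {P : ℕ → Set} (P? : Decidable P) → ¬ P x → count P? J ≡ count P? J′
    restrict P? ¬px = trans (count-↭ P? J↭xJ′) (count-∷-reject P? ¬px)
    x∉J′ : x ∉ J′
    x∉J′ = Unique[x∷xs]⇒x∉xs (Unique-resp-↭ J↭xJ′ u)
    cover : All (λ w → w < x ⊎ x < w) J′
    cover = All.tabulate comparable
      where
        comparable : ∀ {w} → w ∈ J′ → w < x ⊎ x < w
        comparable {w} w∈J′ with <-cmp w x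
        ... | tri< w<x _ _ = inj₁ w<x
        ... | tri≈ _ refl _ = ⊥-elim (x∉J′ w∈J′)
        ... | tri> _ _ x<w = inj₂ x<w

countAbove-injective : ∀ {J w y} → w ∈ J → y ∈ J → countAbove J w ≡ countAbove J y → w ≡ y
countAbove-injective {J} {w} {y} w∈J y∈J eq with <-cmp w y
... | tri< w<y _ _ = ⊥-elim (<-irrefl (sym eq) (countAbove-strict w<y y∈J))
... | tri≈ _ w≡y _ = w≡y
... | tri> _ _ y<w = ⊥-elim (<-irrefl eq (countAbove-strict y<w w∈J))

countAbove-surjective : ∀ {J c} → Unique J → c < length J → ∃ λ y → y ∈ J × countAbove J y ≡ c
countAbove-surjective {x ∷ J} {c} (x∉J ∷ u) c<1+J with <-cmp c (countAbove J x)
... | tri≈ _ c≡r _ = x , here refl , trans (count-∷-reject (x <?_) (<-irrefl refl)) (sym c≡r)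
... | tri< c<r _ _ with countAbove-surjective u (<-≤-trans c<r (length-filter (x <?_) J))
...   | y , y∈J , refl = y , there y∈J , count-∷-reject (y <?_) ¬y<x
  where
    ¬y<x : ¬ y < x
    ¬y<x y<x = <⇒≱ c<r (countAbove-antitone (<⇒≤ y<x) J)
countAbove-surjective {x ∷ J} {suc c} (x∉J ∷ u) (s≤s c<J) | tri> _ _ r<c
  with countAbove-surjective u c<J
... | y , y∈J , refl = y , there y∈J , count-∷-accept (y <?_) y<x
  where
    y<x : y < x
    y<x with <-cmp y x
    ... | tri< y<x _ _ = y<x
    ... | tri≈ _ refl _ = ⊥-elim (All.lookup x∉J y∈J refl)
    ... | tri> _ _ x<y = ⊥-elim (<⇒≱ r<c (countAbove-strict x<y y∈J))

findRank-sound : ∀ {J y c} → y ∈ J → countAbove J y ≡ c →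
                 ∀ L → All (_∈ J) L → y ∈ L → findRank J L c ≡ y
findRank-sound {J} {y} {c} y∈J eq (w ∷ L) (w∈J ∷ L⊆J) y∈wL with countAbove J w ≟ c | y∈wL
... | yes eq′ | _          = countAbove-injective w∈J y∈J (trans eq′ (sym eq))
... | no neq  | here refl  = ⊥-elim (neq eq)
... | no _    | there y∈L = findRank-sound y∈J eq L L⊆J y∈L

σ-≡ : ∀ {J x y} → y ∈ J → countAbove J y ≡ countBelow J x → σ J x ≡ y
σ-≡ {J} y∈J eq = findRank-sound y∈J eq J (All.tabulate id) y∈J

σ-spec : ∀ {J x} → Unique J → x ∈ J → σ J x ∈ J × countAbove J (σ J x) ≡ countBelow J x
σ-spec {J} {x} u x∈J =
  let y , y∈J , eq = countAbove-surjective u below<length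
  in subst (λ z → z ∈ J × countAbove J z ≡ countBelow J x) (sym (σ-≡ y∈J eq)) (y∈J , eq)
  where
    below<length : countBelow J x < length J
    below<length = ≤-trans (s≤s (m≤m+n _ _)) (≤-reflexive (countBelow+countAbove u x∈J))

σ-∈ : ∀ {J x} → Unique J → x ∈ J → σ J x ∈ J
σ-∈ u x∈J = proj₁ (σ-spec u x∈J)

σ-involutive : ∀ {J x} → Unique J → x ∈ J → σ J (σ J x) ≡ x
σ-involutive {J} {x} u x∈J = σ-≡ x∈J (+-cancelˡ-≡ (countBelow J x) _ _ sums)
  where
    open ≡-Reasoning
    s = σ J x
    sums : countBelow J x + countAbove J x ≡ countBelow J x + countBelow J s
    sums = begin
      countBelow J x + countAbove J x ≡⟨ suc-injective (trans (countBelow+countAbove u x∈J)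
                                                               (sym (countBelow+countAbove u (σ-∈ u x∈J)))) ⟩
      countBelow J s + countAbove J s ≡⟨ cong (countBelow J s +_) (proj₂ (σ-spec u x∈J)) ⟩
      countBelow J s + countBelow J x ≡⟨ +-comm (countBelow J s) (countBelow J x) ⟩
      countBelow J x + countBelow J s ∎

σ-antitone : ∀ {J x y} → Unique J → x ∈ J → y ∈ J → x < y → σ J y < σ J x
σ-antitone {J} {x} {y} u x∈J y∈J x<y with σ J y <? σ J x
... | yes σy<σx = σy<σx
... | no σy≮σx  = ⊥-elim (<⇒≱ (countBelow-strict x<y x∈J) below-y≤below-x)
  where
    below-y≤below-x : countBelow J y ≤ countBelow J x
    below-y≤below-x = subst₂ _≤_ (proj₂ (σ-spec u y∈J)) (proj₂ (σ-spec u x∈J))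
                             (countAbove-antitone (≮⇒≥ σy≮σx) J)

σ-max≡min : ∀ {J lo hi} → Unique J → lo ∈ J → hi ∈ J → All (λ z → lo ≤ z × z ≤ hi) J →
            σ J hi ≡ lo
σ-max≡min {J} {lo} {hi} u lo∈J hi∈J bounds = σ-≡ lo∈J (begin
  countAbove J lo                   ≡⟨ cong (_+ countAbove J lo) (sym nothing-below) ⟩
  countBelow J lo + countAbove J lo ≡⟨ suc-injective (trans (countBelow+countAbove u lo∈J)
                                                            (sym (countBelow+countAbove u hi∈J))) ⟩
  countBelow J hi + countAbove J hi ≡⟨ cong (countBelow J hi +_) nothing-above ⟩
  countBelow J hi + 0               ≡⟨ +-identityʳ _ ⟩
  countBelow J hi                   ∎)
  where
    open ≡-Reasoning
    nothing-below : countBelow J lo ≡ 0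
    nothing-below = count-none (_<? lo) (All.map (≤⇒≯ ∘ proj₁) bounds)
    nothing-above : countAbove J hi ≡ 0
    nothing-above = count-none (hi <?_) (All.map (≤⇒≯ ∘ proj₂) bounds)

σ-min≡max : ∀ {J lo hi} → Unique J → lo ∈ J → hi ∈ J → All (λ z → lo ≤ z × z ≤ hi) J →
            σ J lo ≡ hi
σ-min≡max {J} u lo∈J hi∈J bounds =
  trans (cong (σ J) (sym (σ-max≡min u lo∈J hi∈J bounds))) (σ-involutive u hi∈J)

σ-resp-↭ : ∀ {J K x} → J ↭ K → Unique J → x ∈ J → σ K x ≡ σ J x
σ-resp-↭ {J} {K} {x} J↭K u x∈J =
  σ-≡ (∈-resp-↭ J↭K (σ-∈ u x∈J))
      (trans (sym (count-↭ (σ J x <?_) J↭K)) (trans (proj₂ (σ-spec u x∈J)) (count-↭ (_<? x) J↭K)))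

σ-map-↭ : ∀ {J} → Unique J → map (σ J) J ↭ J
σ-map-↭ u = involution⇒map-↭ _ u (σ-∈ u) (σ-involutive u)

σ-image : ∀ {J x} → Unique J → x ∈ J → σ (map (σ J) J) (σ J x) ≡ x
σ-image u x∈J = trans (σ-resp-↭ (↭-sym (σ-map-↭ u)) u (σ-∈ u x∈J)) (σ-involutive u x∈J)

σ-suffix-recover : ∀ {h h′ v} → Unique (h ∷ v) → σ (h ∷ v) h ≡ h′ →
                   map (σ (h′ ∷ map (σ (h ∷ v)) v)) (map (σ (h ∷ v)) v) ≡ v
σ-suffix-recover u refl = trans (sym (map-∘ _)) (map-id-local (All.tabulate (σ-image u ∘ there)))

split-oneFirst : ∀ n u v → 1 ∉ u → n ∉ u → split n (u ++ 1 ∷ v) ≡ oneFirst u v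
split-oneFirst n []      v _   _   = refl
split-oneFirst n (x ∷ u) v 1∉u n∉u with x ≟ 1 | x ≟ n
... | yes x≡1 | _       = ⊥-elim (1∉u (here (sym x≡1)))
... | no _    | yes x≡n = ⊥-elim (n∉u (here (sym x≡n)))
... | no _    | no _    = cong (consSplit x) (split-oneFirst n u v (1∉u ∘ there) (n∉u ∘ there))

split-nFirst : ∀ n u v → n ≢ 1 → 1 ∉ u → n ∉ u → split n (u ++ n ∷ v) ≡ nFirst u v
split-nFirst n [] v n≢1 _ _ with n ≟ 1 | n ≟ n
... | yes n≡1 | _       = ⊥-elim (n≢1 n≡1)
... | no _    | yes _   = refl
... | no _    | no n≢n  = ⊥-elim (n≢n refl)
split-nFirst n (x ∷ u) v n≢1 1∉u n∉u with x ≟ 1 | x ≟ n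
... | yes x≡1 | _       = ⊥-elim (1∉u (here (sym x≡1)))
... | no _    | yes x≡n = ⊥-elim (n∉u (here (sym x≡n)))
... | no _    | no _    = cong (consSplit x) (split-nFirst n u v n≢1 (1∉u ∘ there) (n∉u ∘ there))

ρ-top : ∀ n π → ρ n n π ≡ complement n π
ρ-top n π with n ≟ n
... | yes _   = refl
... | no n≢n = ⊥-elim (n≢n refl)

ρ-oneFirst : ∀ {n k} u v → k ≢ n → 1 ∉ u → n ∉ u → ρ n k (u ++ 1 ∷ v) ≡ reverse u ++ 1 ∷ v
ρ-oneFirst {n} {k} u v k≢n 1∉u n∉u with k ≟ n
... | yes k≡n = ⊥-elim (k≢n k≡n)
... | no _ rewrite split-oneFirst n u v 1∉u n∉u = refl

ρ-nFirst : ∀ {n k} u v → k ≢ n → n ≢ 1 → 1 ∉ u → n ∉ u →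
           ρ n k (u ++ n ∷ v) ≡ reverse u ++ 1 ∷ map (σ (n ∷ v)) v
ρ-nFirst {n} {k} u v k≢n n≢1 1∉u n∉u with k ≟ n
... | yes k≡n = ⊥-elim (k≢n k≡n)
... | no _ rewrite split-nFirst n u v n≢1 1∉u n∉u = refl

MM′-top : ∀ n τ → MM' n n τ ⇔ (MM n τ × ∃[ rest ] τ ≡ 1 ∷ rest)
MM′-top n τ with n ≟ n
... | yes _   = mk⇔ id id
... | no n≢n = ⊥-elim (n≢n refl)

MM′-below : ∀ {n k} τ → k ≢ n → MM' n k τ ⇔ (MM n τ × ∃[ α ] ∃[ β ] τ ≡ α ++ k ∷ 1 ∷ β)
MM′-below {n} {k} τ k≢n with k ≟ n
... | yes k≡n = ⊥-elim (k≢n k≡n)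
... | no _    = mk⇔ id id

-- The case k = n

module Top (n : ℕ) where

  reflect : ℕ → ℕ
  reflect x = suc n ∸ x

  reflect-involutive : ∀ {x} → x ≤ n → reflect (reflect x) ≡ x
  reflect-involutive x≤n = m∸[m∸n]≡n (m≤n⇒m≤1+n x≤n)

  reflect-antitone : ∀ {x y} → y ≤ n → x < y → reflect y < reflect x
  reflect-antitone y≤n x<y = ∸-monoʳ-< x<y (m≤n⇒m≤1+n y≤n)

  reflect-∈ : ∀ {x} → x ∈ [1‥ n ] → reflect x ∈ [1‥ n ]
  reflect-∈ x∈ = let 1≤x , x≤n = ∈-[1‥]⁻ x∈ in
    ∈-[1‥]⁺ (subst (1 ≤_) (sym (+-∸-assoc 1 x≤n)) (s≤s z≤n)) (∸-monoʳ-≤ (suc n) 1≤x)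

  complement-IsPerm : ∀ {π} → IsPerm n π → IsPerm n (complement n π)
  complement-IsPerm p = ↭-trans (Perm.map⁺ reflect p)
    (involution⇒map-↭ reflect (Unique-[1‥] n) reflect-∈ (reflect-involutive ∘ proj₂ ∘ ∈-[1‥]⁻))

  complement-involutive : ∀ {π} → IsPerm n π → complement n (complement n π) ≡ π
  complement-involutive p = trans (sym (map-∘ _))
    (map-id-local (All.tabulate (reflect-involutive ∘ proj₂ ∘ IsPerm-∈⁻ p)))

  complement-Zigzag : ∀ {π} d → IsPerm n π → Zigzag d π → Zigzag (not d) (complement n π)
  complement-Zigzag d p = Zigzag-antitone (_≤ n) reflect (λ _ y≤n → reflect-antitone y≤n) d _
    (All.tabulate (proj₂ ∘ IsPerm-∈⁻ p))

  forward : ∀ π → DU n n π → MM' n n (ρ n n π)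
  forward π (p , ds , rest , refl) = subst (MM' n n) (sym (ρ-top n π)) (Equivalence.from (MM′-top n _)
    ((complement-IsPerm p , alternating , [] , _ , starts-with-1 , λ ()) , _ , starts-with-1))
    where
      starts-with-1 : complement n π ≡ 1 ∷ complement n rest
      starts-with-1 = cong (_∷ complement n rest) (m+n∸n≡m 1 n)
      alternating : Alternating (complement n π)
      alternating = Zigzag⇒Alternating false (complement-Zigzag true p (DownStart⇒Zigzag π ds))

  injective : ∀ π π′ → DU n n π → DU n n π′ → ρ n n π ≡ ρ n n π′ → π ≡ π′
  injective π π′ (p , _) (p′ , _) eq = begin
    π                                   ≡⟨ complement-involutive p ⟨
    complement n (complement n π)       ≡⟨ cong (complement n) complements≡ ⟩
    complement n (complement n π′)      ≡⟨ complement-involutive p′ ⟩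
    π′                                  ∎
    where
      open ≡-Reasoning
      complements≡ : complement n π ≡ complement n π′
      complements≡ = trans (sym (ρ-top n π)) (trans eq (ρ-top n π′))

  surjective : ∀ τ → MM' n n τ → ∃[ π ] (DU n n π × ρ n n π ≡ τ)
  surjective τ mm with Equivalence.to (MM′-top n τ) mm
  ... | (p , alt , _) , rest , refl =
    complement n τ , (complement-IsPerm p , Zigzag⇒DownStart _ down , _ , refl) ,
    trans (ρ-top n _) (complement-involutive p)
    where
      up : Zigzag false τ
      up = let d , z = Alternating⇒Zigzag alt in
        Zigzag-from-extremum d false 1 rest z (IsPerm-suffix-1< [] p)
      down : Zigzag true (complement n τ)
      down = complement-Zigzag false p up

-- The case k < n

module Below {n k : ℕ} (1≤k : 1 ≤ k) (k<n : k < n) where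

  k≢n : k ≢ n
  k≢n = <⇒≢ k<n

  1≤n : 1 ≤ n
  1≤n = ≤-trans 1≤k (<⇒≤ k<n)

  n≢1 : n ≢ 1
  n≢1 n≡1 = <⇒≱ (subst (k <_) n≡1 k<n) 1≤k

  data Shape : List ℕ → Set where
    one-first : ∀ s v → 1 ∉ k ∷ s → n ∉ k ∷ s → Shape ((k ∷ s) ++ 1 ∷ v)
    top-first : ∀ s v → 1 ∉ k ∷ s → n ∉ k ∷ s → Shape ((k ∷ s) ++ n ∷ v)

  shape : ∀ {π} → DU n k π → Shape π
  shape {π} (p , ds , rest , π≡k∷rest) with first-of 1 n π (IsPerm-∈⁺ p ≤-refl 1≤n)
  ... | [] , v , inj₁ refl , _ , _ = ⊥-elim (one-not-first v p ds)
    where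
      one-not-first : ∀ v → IsPerm n (1 ∷ v) → DownStart (1 ∷ v) → ⊥
      one-not-first []      p _ with IsPerm-∈⁺ p 1≤n ≤-refl
      ... | here n≡1 = n≢1 n≡1
      one-not-first (b ∷ v) p (b<1 , _) = <⇒≱ b<1 (proj₁ (IsPerm-∈⁻ p (there (here refl))))
  ... | [] , v , inj₂ refl , _ , _ = ⊥-elim (k≢n (sym (∷-injectiveˡ π≡k∷rest)))
  ... | x ∷ s , v , inj₁ refl , 1∉ , n∉ with ∷-injectiveˡ π≡k∷rest
  ...   | refl = one-first s v 1∉ n∉
  shape {π} (p , ds , rest , π≡k∷rest) | x ∷ s , v , inj₂ refl , 1∉ , n∉ with ∷-injectiveˡ π≡k∷rest
  ...   | refl = top-first s v 1∉ n∉

  MM′-reversed : ∀ s X → IsPerm n (reverse (k ∷ s) ++ 1 ∷ X) → Zigzag true (k ∷ s) →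
                 All (1 <_) (k ∷ s) → n ∉ k ∷ s → Zigzag false (1 ∷ X) → MM' n k (reverse (k ∷ s) ++ 1 ∷ X)
  MM′-reversed s X p zks 1<ks n∉ks z1X = Equivalence.from (MM′-below _ k≢n)
    ( (p , Zigzag⇒Alternating _ zigzag , reverse (k ∷ s) , X , refl , ∉-reverse (k ∷ s) n∉ks)
    , reverse s , X , reverse-∷-++ k s (1 ∷ X))
    where
      zigzag : Zigzag _ (reverse (k ∷ s) ++ 1 ∷ X)
      zigzag = Zigzag-reverse-prefix true (k ∷ s) 1 X zks 1<ks z1X

  module _ {s m v} (du : DU n k ((k ∷ s) ++ m ∷ v)) where

    private
      p = proj₁ du

    DU-zigzag : Zigzag true ((k ∷ s) ++ m ∷ v)
    DU-zigzag = DownStart⇒Zigzag _ (proj₁ (proj₂ du))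

    prefix-zigzag : Zigzag true (k ∷ s)
    prefix-zigzag = Zigzag-++ˡ true (k ∷ s) (m ∷ v) DU-zigzag

    suffix-zigzag : Zigzag (dirAfter (length (k ∷ s)) true) (m ∷ v)
    suffix-zigzag = Zigzag-++ʳ true (k ∷ s) m v DU-zigzag

    suffix-unique : Unique (m ∷ v)
    suffix-unique = Unique-++⁻ʳ (k ∷ s) (IsPerm⇒Unique p)

    prefix-1< : 1 ∉ k ∷ s → All (1 <_) (k ∷ s)
    prefix-1< = IsPerm-1<-all p ∈-++⁺ˡ

    prefix-<n : n ∉ k ∷ s → All (_< n) (k ∷ s)
    prefix-<n = IsPerm-<n-all p ∈-++⁺ˡ

    suffix-⊆ : ∀ {x} → x ∈ m ∷ v → x ∈ (k ∷ s) ++ m ∷ v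
    suffix-⊆ = ∈-++⁺ʳ (k ∷ s)

  forward-one-first : ∀ s v → DU n k ((k ∷ s) ++ 1 ∷ v) → 1 ∉ k ∷ s → n ∉ k ∷ s →
                      MM' n k (reverse (k ∷ s) ++ 1 ∷ v)
  forward-one-first s v du 1∉ n∉ =
    MM′-reversed s v (IsPerm-reverse-prefix (k ∷ s) p) (prefix-zigzag du) (prefix-1< du 1∉) n∉
      (Zigzag-from-extremum _ false 1 v (suffix-zigzag du) (IsPerm-suffix-1< (k ∷ s) p))
    where
      p = proj₁ du

  module TopFirst s v (du : DU n k ((k ∷ s) ++ n ∷ v)) (1∉ : 1 ∉ k ∷ s) where

    J = n ∷ v
    X = map (σ J) v

    σ-n≡1 : σ J n ≡ 1
    σ-n≡1 = σ-max≡min (suffix-unique du) 1∈J (here refl)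
                      (All.tabulate (IsPerm-∈⁻ (proj₁ du) ∘ suffix-⊆ du))
      where
        1∈J : 1 ∈ J
        1∈J with ∈-++⁻ (k ∷ s) (IsPerm-∈⁺ (proj₁ du) ≤-refl 1≤n)
        ... | inj₁ 1∈ks = ⊥-elim (1∉ 1∈ks)
        ... | inj₂ 1∈J = 1∈J

    σ-image-J : map (σ J) J ≡ 1 ∷ X
    σ-image-J = cong (_∷ X) σ-n≡1

    image-IsPerm : IsPerm n (reverse (k ∷ s) ++ 1 ∷ X)
    image-IsPerm = ↭-trans (Perm.++⁺ (↭-reverse (k ∷ s)) (subst (_↭ J) σ-image-J (σ-map-↭ (suffix-unique du))))
                           (proj₁ du)

    image-zigzag : Zigzag false (1 ∷ X)
    image-zigzag = subst (Zigzag false) σ-image-J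
      (Zigzag-antitone (_∈ J) (σ J) (σ-antitone (suffix-unique du)) true J (All.tabulate id) J-zigzag)
      where
        J-zigzag : Zigzag true J
        J-zigzag = Zigzag-from-extremum _ true n v (suffix-zigzag du) (IsPerm-suffix-<n (k ∷ s) (proj₁ du))

    forward-top-first : n ∉ k ∷ s → MM' n k (reverse (k ∷ s) ++ 1 ∷ X)
    forward-top-first n∉ = MM′-reversed s X image-IsPerm (prefix-zigzag du) (prefix-1< du 1∉) n∉ image-zigzag

  forward : ∀ π → DU n k π → MM' n k (ρ n k π)
  forward π du with shape du
  ... | one-first s v 1∉ n∉ rewrite ρ-oneFirst (k ∷ s) v k≢n 1∉ n∉ = forward-one-first s v du 1∉ n∉
  ... | top-first s v 1∉ n∉ rewrite ρ-nFirst (k ∷ s) v k≢n n≢1 1∉ n∉ =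
    TopFirst.forward-top-first s v du 1∉ n∉

  one-first-parity : ∀ s v → DU n k ((k ∷ s) ++ 1 ∷ v) → 1 ∉ k ∷ s → dirAfter (length s) true ≡ true
  one-first-parity s v du 1∉ = Zigzag-into-extremum true true k s v (DU-zigzag du) (prefix-1< du 1∉)

  top-first-parity : ∀ s v → DU n k ((k ∷ s) ++ n ∷ v) → n ∉ k ∷ s → dirAfter (length s) true ≡ false
  top-first-parity s v du n∉ = Zigzag-into-extremum true false k s v (DU-zigzag du) (prefix-<n du n∉)

  reversed-injective : ∀ {s s′ X X′} → 1 ∉ k ∷ s → 1 ∉ k ∷ s′ →
                       reverse (k ∷ s) ++ 1 ∷ X ≡ reverse (k ∷ s′) ++ 1 ∷ X′ → s ≡ s′ × X ≡ X′
  reversed-injective {s} {s′} 1∉ 1∉′ eq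
    with ++-∷-injective (reverse (k ∷ s)) _ (reverse (k ∷ s′)) _ (∉-reverse _ 1∉) (∉-reverse _ 1∉′) eq
  ... | rev≡ , X≡ = ∷-injectiveʳ (reverse-injective rev≡) , X≡

  prefix image : ∀ {π} → Shape π → List ℕ
  prefix (one-first s _ _ _) = s
  prefix (top-first s _ _ _) = s
  image (one-first _ v _ _) = v
  image (top-first _ v _ _) = map (σ (n ∷ v)) v

  1∉prefix : ∀ {π} (sh : Shape π) → 1 ∉ k ∷ prefix sh
  1∉prefix (one-first _ _ 1∉ _) = 1∉
  1∉prefix (top-first _ _ 1∉ _) = 1∉

  ρ-shape : ∀ {π} (sh : Shape π) → ρ n k π ≡ reverse (k ∷ prefix sh) ++ 1 ∷ image sh
  ρ-shape (one-first s v 1∉ n∉) = ρ-oneFirst (k ∷ s) v k≢n 1∉ n∉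
  ρ-shape (top-first s v 1∉ n∉) = ρ-nFirst (k ∷ s) v k≢n n≢1 1∉ n∉

  -- The parity of |prefix| tells which of 1 and n came first.
  same-images : ∀ {π π′} (sh : Shape π) (sh′ : Shape π′) → DU n k π → DU n k π′ →
                prefix sh ≡ prefix sh′ → image sh ≡ image sh′ → π ≡ π′
  same-images (one-first s v _ _) (one-first _ _ _ _) _ _ refl refl = refl
  same-images (one-first s v 1∉ _) (top-first _ v′ _ n∉′) du du′ refl _
    with trans (sym (one-first-parity s v du 1∉)) (top-first-parity s v′ du′ n∉′)
  ... | ()
  same-images (top-first s v _ n∉) (one-first _ v′ 1∉′ _) du du′ refl _
    with trans (sym (one-first-parity s v′ du′ 1∉′)) (top-first-parity s v du n∉)
  ... | ()
  same-images (top-first s v 1∉ n∉) (top-first _ v′ 1∉′ n∉′) du du′ refl X≡X′ =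
    cong (λ w → (k ∷ s) ++ n ∷ w) (begin
      v                        ≡⟨ σ-suffix-recover (suffix-unique du) (TopFirst.σ-n≡1 s v du 1∉) ⟨
      map (σ (1 ∷ X)) X        ≡⟨ cong (λ X → map (σ (1 ∷ X)) X) X≡X′ ⟩
      map (σ (1 ∷ X′)) X′      ≡⟨ σ-suffix-recover (suffix-unique du′) (TopFirst.σ-n≡1 s v′ du′ 1∉′) ⟩
      v′                       ∎)
    where
      open ≡-Reasoning
      X = image (top-first s v 1∉ n∉)
      X′ = image (top-first s v′ 1∉′ n∉′)

  injective : ∀ π π′ → DU n k π → DU n k π′ → ρ n k π ≡ ρ n k π′ → π ≡ π′
  injective π π′ du du′ eq =
    let s≡s′ , X≡X′ = reversed-injective (1∉prefix sh) (1∉prefix sh′)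
                                         (trans (sym (ρ-shape sh)) (trans eq (ρ-shape sh′)))
    in same-images sh sh′ du du′ s≡s′ X≡X′
    where
      sh = shape du
      sh′ = shape du′

  module Preimage α β (p : IsPerm n (α ++ k ∷ 1 ∷ β)) (one-before-n : OneBeforeN n (α ++ k ∷ 1 ∷ β))
                  d (z : Zigzag d (α ++ k ∷ 1 ∷ β)) where

    u = α ++ [ k ]
    K = 1 ∷ β

    τ≡u1β : α ++ k ∷ 1 ∷ β ≡ u ++ 1 ∷ β
    τ≡u1β = sym (++-assoc α [ k ] (1 ∷ β))

    pu : IsPerm n (u ++ 1 ∷ β)
    pu = subst (IsPerm n) τ≡u1β p

    zu : Zigzag d (u ++ 1 ∷ β)
    zu = subst (Zigzag d) τ≡u1β z

    1∉u : 1 ∉ u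
    1∉u = Unique-∉-prefix u (IsPerm⇒Unique pu)

    n∉u : n ∉ u
    n∉u = let α′ , β′ , τ≡α′1β′ , n∉α′ = one-before-n
              1∉α′ = Unique-∉-prefix α′ (IsPerm⇒Unique (subst (IsPerm n) τ≡α′1β′ p))
              u≡α′ , _ = ++-∷-injective u β α′ β′ 1∉u 1∉α′ (trans (sym τ≡u1β) τ≡α′1β′)
          in subst (n ∉_) (sym u≡α′) n∉α′

    -- k descends into 1, which fixes the parity of |α| relative to d.
    direction : dirAfter (length u) (not d) ≡ true
    direction = trans (dirAfter-∷ʳ α d) (Step-determined _ true (Zigzag-step d α β z) 1<k)
      where
        1<k : 1 < k
        1<k = IsPerm-1< pu (∈-++⁺ˡ (∈-++⁺ʳ α (here refl))) (λ { refl → 1∉u (∈-++⁺ʳ α (here refl)) })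

    reversed-DU : ∀ m w → IsPerm n (reverse u ++ m ∷ w) →
                  Zigzag (dirAfter (length u) (not d)) (reverse u ++ m ∷ w) → DU n k (reverse u ++ m ∷ w)
    reversed-DU m w pπ zπ = pπ , Zigzag⇒DownStart _ (subst (λ e → Zigzag e _) direction zπ) ,
                            reverse α ++ m ∷ w , cong (_++ m ∷ w) (reverse-++ α [ k ])

    uK : Unique K
    uK = Unique-++⁻ʳ u (IsPerm⇒Unique pu)

    u-zigzag : Zigzag d u
    u-zigzag = Zigzag-++ˡ d u K zu

    K-zigzag : Zigzag false K
    K-zigzag = Zigzag-from-extremum _ false 1 β (Zigzag-++ʳ d u 1 β zu) (IsPerm-suffix-1< u pu)

    unreverse : ∀ {w} → w ≡ β → reverse (reverse u) ++ 1 ∷ w ≡ α ++ k ∷ 1 ∷ β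
    unreverse w≡β = trans (cong₂ (λ a b → a ++ 1 ∷ b) (reverse-involutive u) w≡β) (sym τ≡u1β)

  preimage : ∀ α β → IsPerm n (α ++ k ∷ 1 ∷ β) → OneBeforeN n (α ++ k ∷ 1 ∷ β) →
             ∀ d → Zigzag d (α ++ k ∷ 1 ∷ β) → ∃[ π ] (DU n k π × ρ n k π ≡ α ++ k ∷ 1 ∷ β)
  preimage α β p one-before-n true z =
    reverse u ++ 1 ∷ β , reversed-DU 1 β (IsPerm-reverse-prefix u pu) zπ ,
    trans (ρ-oneFirst (reverse u) β k≢n (∉-reverse u 1∉u) (∉-reverse u n∉u)) (unreverse refl)
    where
      open Preimage α β p one-before-n true z
      zπ : Zigzag (dirAfter (length u) false) (reverse u ++ 1 ∷ β)
      zπ = Zigzag-reverse-prefix true u 1 β u-zigzag (IsPerm-1<-all pu ∈-++⁺ˡ 1∉u) K-zigzag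
  preimage α β p one-before-n false z =
    reverse u ++ n ∷ Y , reversed-DU n Y pπ zπ ,
    trans (ρ-nFirst (reverse u) Y k≢n n≢1 (∉-reverse u 1∉u) (∉-reverse u n∉u))
          (unreverse (σ-suffix-recover uK σ-1≡n))
    where
      open Preimage α β p one-before-n false z
      Y = map (σ K) β
      n∈β : n ∈ β
      n∈β with ∈-++⁻ u (IsPerm-∈⁺ pu 1≤n ≤-refl)
      ... | inj₁ n∈u          = ⊥-elim (n∉u n∈u)
      ... | inj₂ (here n≡1)   = ⊥-elim (n≢1 n≡1)
      ... | inj₂ (there n∈β) = n∈β
      σ-1≡n : σ K 1 ≡ n
      σ-1≡n = σ-min≡max uK (here refl) (there n∈β) (All.tabulate (IsPerm-∈⁻ pu ∘ ∈-++⁺ʳ u))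
      σ-image-K : map (σ K) K ≡ n ∷ Y
      σ-image-K = cong (_∷ Y) σ-1≡n
      pπ : IsPerm n (reverse u ++ n ∷ Y)
      pπ = ↭-trans (Perm.++⁺ (↭-reverse u) (subst (_↭ K) σ-image-K (σ-map-↭ uK))) pu
      zπ : Zigzag (dirAfter (length u) true) (reverse u ++ n ∷ Y)
      zπ = Zigzag-reverse-prefix false u n Y u-zigzag (IsPerm-<n-all pu ∈-++⁺ˡ n∉u)
             (subst (Zigzag true) σ-image-K
               (Zigzag-antitone (_∈ K) (σ K) (σ-antitone uK) false K (All.tabulate id) K-zigzag))

  surjective : ∀ τ → MM' n k τ → ∃[ π ] (DU n k π × ρ n k π ≡ τ)
  surjective τ mm with Equivalence.to (MM′-below τ k≢n) mm
  ... | (p , alt , one-before-n) , α , β , refl =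
    let d , z = Alternating⇒Zigzag alt in preimage α β p one-before-n d z

theorem8 : (n k : ℕ) → 1 ≤ n → 1 ≤ k → k ≤ n →
    ((π : List ℕ) → DU n k π → MM' n k (ρ n k π))
    × ((π π′ : List ℕ) → DU n k π → DU n k π′ → ρ n k π ≡ ρ n k π′ → π ≡ π′)
    × ((τ : List ℕ) → MM' n k τ → ∃[ π ] (DU n k π × ρ n k π ≡ τ))
theorem8 n k _ 1≤k k≤n = case k ≟ n of λ where   -- 1 ≤ n follows from 1 ≤ k ≤ n
  (yes refl) → Top.forward n , Top.injective n , Top.surjective n
  (no k≢n)   → let k<n = ≤∧≢⇒< k≤n k≢n in
                Below.forward 1≤k k<n , Below.injective 1≤k k<n , Below.surjective 1≤k k<n
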